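{- Let $(\beta,\gamma)$ be antiferromagnetic and $\lambda>0$. Let $\mathcal{T}_1,\dots,\mathcal{T}_k$ be rooted trees with roots $\rho_1,\dots,\rho_k$, effective fields $R_1,\dots,R_k$ and magnetization gaps $M_1,\dots,M_k$. Let $\mathcal{T}$ be the tree with root $\rho$ obtained by taking a new edge $\{\rho,u\}$ and identifying the roots $\rho_1,\dots,\rho_k$ with $u$. Let $R$ and $M$ be the effective field and magnetization gap of $\mathcal{T}$. Then $$R=\frac{1+\gamma\lambda\prod_{i=1}^k R_i}{\beta+\lambda\prod_{i=1}^k R_i},\qquad M=1-\omega(R)\Big(1+\sum_{i=1}^k(M_i-1)\Big),\qquad\text{where }\ \omega(R):=\frac{1+\beta\gamma-\beta R-\gamma/R}{1-\beta\gamma}.$$ Moreover $R\in(\gamma,1/\beta)$ (with $1/\beta=\infty$ if $\beta=0$) and $0<\omega(R)<1$.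
   Context: $(\beta,\gamma)$ is antiferromagnetic if $\beta,\gamma\ge0$, $\beta\gamma\in[0,1)$ and not both are zero. For a graph $G=(V,E)$ the Gibbs distribution is $\mu_{G;\beta,\gamma,\lambda}(\sigma)\propto\lambda^{|\sigma|}\beta^{m_0(\sigma)}\gamma^{m_1(\sigma)}$ for $\sigma:V\to\{0,1\}$, where $|\sigma|=\sum_v\sigma(v)$ and $m_0,m_1$ count edges whose endpoints both have spin $0$, resp. $1$ (with $0^0=1$). For a rooted tree $\mathcal{T}$ with root $\rho$ and $\mu=\mu_{\mathcal{T};\beta,\gamma,\lambda}$, the effective field is $R_{\mathcal{T}}=\frac{1}{\lambda}\frac{\mu(\sigma(\rho)=1)}{\mu(\sigma(\rho)=0)}$ and the magnetization gap is $M_{\mathcal{T}}=\mathbf{E}_\mu[|\sigma|\mid\sigma(\rho)=1]-\mathbf{E}_\mu[|\sigma|\mid\sigma(\rho)=0]$ (the root is counted in $|\sigma|$). -}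

module Defs where

open import Level using (0ℓ)
open import Data.Bool using (Bool; true; false)
open import Data.Nat as ℕ using (ℕ; zero; suc)
open import Data.List using (List; []; _∷_; _++_; foldr; map; concatMap)
open import Data.Sum using (_⊎_)
open import Data.Product using (_×_)
open import Relation.Nullary using (¬_)
open import Relation.Binary.PropositionalEquality using (_≡_)
import Algebra.Structures as AS
import Relation.Binary.Structures as RS

-- Ordered fields (with a total inverse, 0⁻¹ = 0 by convention).
-- The real numbers are an instance; the theorem is stated for every
-- ordered field, which in particular covers ℝ.

record OrderedField : Set₁ where
  infixl 6 _+_ _-_
  infixl 7 _*_
  infix 4 _<_ _≤_
  field
    Carrier : Set
    _+_ _*_ : Carrier → Carrier → Carrier
    -_ : Carrier → Carrier
    _⁻¹ : Carrier → Carrier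
    0# 1# : Carrier
    _<_ : Carrier → Carrier → Set
    isCommutativeRing : AS.IsCommutativeRing {A = Carrier} _≡_ _+_ _*_ -_ 0# 1#
    0≢1 : ¬ (0# ≡ 1#)
    ⁻¹-inverse : ∀ x → ¬ (x ≡ 0#) → x * (x ⁻¹) ≡ 1#
    ⁻¹-zero : 0# ⁻¹ ≡ 0#
    isStrictTotalOrder : RS.IsStrictTotalOrder {A = Carrier} _≡_ _<_
    +-mono-< : ∀ {x y} z → x < y → x + z < y + z
    *-pos : ∀ {x y} → 0# < x → 0# < y → 0# < x * y

  _-_ : Carrier → Carrier → Carrier
  x - y = x + (- y)

  _≤_ : Carrier → Carrier → Set
  x ≤ y = x < y ⊎ x ≡ y

  _^_ : Carrier → ℕ → Carrier
  x ^ zero = 1#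
  x ^ suc n = x * (x ^ n)

  fromℕ : ℕ → Carrier
  fromℕ zero = 0#
  fromℕ (suc n) = 1# + fromℕ n

  Σ[_] : List Carrier → Carrier
  Σ[_] = foldr _+_ 0#

  Π[_] : List Carrier → Carrier
  Π[_] = foldr _*_ 1#

data Tree : Set where
  node : List Tree → Tree

children : Tree → List Tree
children (node ts) = ts

-- The tree with root ρ obtained from a new edge {ρ,u} by identifying
-- the roots of T₁,…,T_k with u: u's children are all children of the
-- roots ρᵢ.
glue : List Tree → Tree
glue Ts = node (node (concatMap children Ts) ∷ [])

-- Spin configurations σ : V → {0,1} on a tree (true = spin 1).
mutual
  data Conf : Tree → Set where
    cnode : ∀ {ts} → Bool → Confs ts → Conf (node ts)

  data Confs : List Tree → Set where
    []  : Confs []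
    _∷_ : ∀ {t ts} → Conf t → Confs ts → Confs (t ∷ ts)

rootSpin : ∀ {t} → Conf t → Bool
rootSpin (cnode b _) = b

mutual
  allConf : (t : Tree) → List (Conf t)
  allConf (node ts) = concatMap (λ b → map (cnode b) (allConfs ts)) (true ∷ false ∷ [])

  allConfs : (ts : List Tree) → List (Confs ts)
  allConfs [] = [] ∷ []
  allConfs (t ∷ ts) = concatMap (λ c → map (c ∷_) (allConfs ts)) (allConf t)

b2n : Bool → ℕ
b2n true = 1
b2n false = 0

both0 both1 : Bool → Bool → ℕ
both0 false false = 1
both0 _ _ = 0
both1 true true = 1
both1 _ _ = 0

mutual
  size : ∀ {t} → Conf t → ℕ
  size (cnode b cs) = b2n b ℕ.+ sizes cs

  sizes : ∀ {ts} → Confs ts → ℕ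
  sizes [] = 0
  sizes (c ∷ cs) = size c ℕ.+ sizes cs

mutual
  m0 : ∀ {t} → Conf t → ℕ
  m0 (cnode b cs) = m0s b cs

  m0s : ∀ {ts} → Bool → Confs ts → ℕ
  m0s p [] = 0
  m0s p (c ∷ cs) = both0 p (rootSpin c) ℕ.+ m0 c ℕ.+ m0s p cs

mutual
  m1 : ∀ {t} → Conf t → ℕ
  m1 (cnode b cs) = m1s b cs

  m1s : ∀ {ts} → Bool → Confs ts → ℕ
  m1s p [] = 0
  m1s p (c ∷ cs) = both1 p (rootSpin c) ℕ.+ m1 c ℕ.+ m1s p cs

module Gibbs (F : OrderedField) where
  open OrderedField F

  antiferromagnetic : Carrier → Carrier → Set
  antiferromagnetic β γ =
    (0# ≤ β) × (0# ≤ γ) × (0# ≤ β * γ) × (β * γ < 1#)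
      × ¬ ((β ≡ 0#) × (γ ≡ 0#))

  module _ (β γ λ' : Carrier) (t : Tree) where

    weight : Conf t → Carrier
    weight σ = (λ' ^ size σ) * (β ^ m0 σ) * (γ ^ m1 σ)

    Z : Carrier
    Z = Σ[ map weight (allConf t) ]

    μ : Conf t → Carrier
    μ σ = weight σ * (Z ⁻¹)

    [root≡_] : Bool → Conf t → Carrier
    [root≡ true ] σ with rootSpin σ
    ... | true = 1#
    ... | false = 0#
    [root≡ false ] σ with rootSpin σ
    ... | true = 0#
    ... | false = 1#

    Prob-root : Bool → Carrier
    Prob-root s = Σ[ map (λ σ → [root≡ s ] σ * μ σ) (allConf t) ]

    CondExpSize : Bool → Carrier
    CondExpSize s =
      Σ[ map (λ σ → fromℕ (size σ) * ([root≡ s ] σ * μ σ)) (allConf t) ] * (Prob-root s ⁻¹)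

    effField : Carrier
    effField = (λ' ⁻¹) * (Prob-root true * (Prob-root false ⁻¹))

    magGap : Carrier
    magGap = CondExpSize true - CondExpSize false

  ω : Carrier → Carrier → Carrier → Carrier
  ω β γ R = (1# + β * γ - β * R - γ * (R ⁻¹)) * ((1# - β * γ) ⁻¹)

-- Let Z_p(ts) be the partition function of a forest ts hanging below a vertex of spin p,
-- and V_p(ts) its size-weighted version. Z_p is multiplicative under concatenation and
-- V_p obeys the product rule, so the effective field of a node is the product of the
-- ratios Z₁/Z₀ over its children, and its magnetization gap minus 1 is the sum of the
-- differences V₁/Z₁ − V₀/Z₀. The glued tree is a root with the single child u whose
-- children are those of all ρᵢ; dividing by Z₀ of u's forest, everything depends only on
-- P = λ ∏ Rᵢ and the mean sizes of that forest. This gives R = (1 + γP)/(β + P), and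
-- conditioning on the spin of u makes the mean size below ρ an average with weights
-- πₛ = μ(σ(u) = 1 | σ(ρ) = s). The identity ω(R) = π₀ − π₁ turns this into the formula
-- for M, and closed forms of R − γ, 1 − βR, π₀ − π₁ and 1 − (π₀ − π₁) give the bounds.

module Submission where

open import Level using (0ℓ)
open import Defs
open import Data.Bool using (Bool; true; false)
open import Data.Nat as ℕ using (ℕ; zero; suc)
import Data.Nat.Properties as ℕ
open import Data.Integer as ℤ using (ℤ; -[1+_])
import Data.Integer.Properties as ℤ
open import Data.Sign as Sign using ()
open import Data.List using (List; []; _∷_; _++_; map; concatMap)
open import Data.List.Properties using (map-cong; map-∘)
open import Data.Maybe using (Maybe; just; nothing)
open import Data.Product using (_×_; _,_)
open import Data.Sum as ⊎ using (_⊎_; inj₁; inj₂)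
open import Data.Empty using (⊥-elim)
open import Relation.Nullary using (¬_; yes; no)
open import Relation.Binary.PropositionalEquality as ≡ using (_≡_; _≢_)
open import Relation.Binary.Definitions using (tri<; tri≈; tri>)
open import Algebra.Bundles using (CommutativeRing)
import Relation.Binary.Structures as RS

module IntegerCoefficients {c ℓ} (R : CommutativeRing c ℓ) where
  open CommutativeRing R
  open import Algebra.Properties.Ring ring
    using (-‿involutive; -‿distribˡ-*; -‿distribʳ-*; -0#≈0#; -‿+-comm)
  open import Algebra.Properties.Semiring.Mult.TCOptimised semiring
    using (1+×; ×-homo-+; ×1-homo-*) renaming (_×_ to _×′_)
  open import Algebra.Solver.Ring.AlmostCommutativeRing
  open import Relation.Binary.Reasoning.Setoid setoid

  -- the type-checking optimised multiple satisfies 1 ×′ x = x definitionally, so the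
  -- solver constant :1 below denotes 1# itself
  ι : ℤ → Carrier
  ι (ℤ.+ n)  = n ×′ 1#
  ι -[1+ n ] = - (suc n ×′ 1#)

  ι-neg : ∀ i → ι (ℤ.- i) ≈ - ι i
  ι-neg (ℤ.+ zero)    = sym -0#≈0#
  ι-neg (ℤ.+ suc n)   = refl
  ι-neg -[1+ n ]      = sym (-‿involutive _)

  ι-◃⁺ : ∀ n → ι (Sign.+ ℤ.◃ n) ≈ n ×′ 1#
  ι-◃⁺ n = reflexive (≡.cong ι (ℤ.+◃n≡+n n))

  ι-◃⁻ : ∀ n → ι (Sign.- ℤ.◃ n) ≈ - (n ×′ 1#)
  ι-◃⁻ n = trans (reflexive (≡.cong ι (ℤ.-◃n≡-n n))) (ι-neg (ℤ.+ n))

  [1+x]-[1+y]≈x-y : ∀ x y → (1# + x) - (1# + y) ≈ x - y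
  [1+x]-[1+y]≈x-y x y = begin
    (1# + x) + - (1# + y)      ≈⟨ +-congˡ (-‿+-comm 1# y) ⟨
    (1# + x) + (- 1# + - y)    ≈⟨ +-congʳ (+-comm 1# x) ⟩
    (x + 1#) + (- 1# + - y)    ≈⟨ +-assoc x 1# _ ⟩
    x + (1# + (- 1# + - y))    ≈⟨ +-congˡ (+-assoc 1# (- 1#) (- y)) ⟨
    x + ((1# + - 1#) + - y)    ≈⟨ +-congˡ (+-congʳ (-‿inverseʳ 1#)) ⟩
    x + (0# + - y)             ≈⟨ +-congˡ (+-identityˡ (- y)) ⟩
    x - y                      ∎

  ι-⊖ : ∀ m n → ι (m ℤ.⊖ n) ≈ m ×′ 1# - n ×′ 1#
  ι-⊖ zero    zero    = sym (-‿inverseʳ 0#)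
  ι-⊖ zero    (suc n) = sym (+-identityˡ _)
  ι-⊖ (suc m) zero    = sym (trans (+-congˡ -0#≈0#) (+-identityʳ _))
  ι-⊖ (suc m) (suc n) = begin
    ι (suc m ℤ.⊖ suc n)                ≡⟨ ≡.cong ι (ℤ.[1+m]⊖[1+n]≡m⊖n m n) ⟩
    ι (m ℤ.⊖ n)                        ≈⟨ ι-⊖ m n ⟩
    m ×′ 1# - n ×′ 1#                  ≈⟨ [1+x]-[1+y]≈x-y _ _ ⟨
    (1# + m ×′ 1#) - (1# + n ×′ 1#)    ≈⟨ +-cong (1+× m 1#) (-‿cong (1+× n 1#)) ⟨
    suc m ×′ 1# - suc n ×′ 1#          ∎

  ι-+ : ∀ i j → ι (i ℤ.+ j) ≈ ι i + ι j
  ι-+ -[1+ m ] -[1+ n ] = begin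
    - (suc (suc (m ℕ.+ n)) ×′ 1#)        ≡⟨ ≡.cong (λ k → - (suc k ×′ 1#)) (ℕ.+-suc m n) ⟨
    - ((suc m ℕ.+ suc n) ×′ 1#)          ≈⟨ -‿cong (×-homo-+ 1# (suc m) (suc n)) ⟩
    - (suc m ×′ 1# + suc n ×′ 1#)        ≈⟨ -‿+-comm _ _ ⟨
    - (suc m ×′ 1#) + - (suc n ×′ 1#)    ∎
  ι-+ -[1+ m ] (ℤ.+ n)  = trans (ι-⊖ n (suc m)) (+-comm _ _)
  ι-+ (ℤ.+ m)  -[1+ n ] = ι-⊖ m (suc n)
  ι-+ (ℤ.+ m)  (ℤ.+ n)  = ×-homo-+ 1# m n

  ι-* : ∀ i j → ι (i ℤ.* j) ≈ ι i * ι j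
  ι-* -[1+ m ] -[1+ n ] = begin
    ι (Sign.+ ℤ.◃ (suc m ℕ.* suc n))     ≈⟨ ι-◃⁺ (suc m ℕ.* suc n) ⟩
    (suc m ℕ.* suc n) ×′ 1#              ≈⟨ ×1-homo-* (suc m) (suc n) ⟩
    suc m ×′ 1# * suc n ×′ 1#            ≈⟨ -‿involutive _ ⟨
    - - (suc m ×′ 1# * suc n ×′ 1#)      ≈⟨ -‿cong (-‿distribˡ-* _ _) ⟩
    - (- (suc m ×′ 1#) * suc n ×′ 1#)    ≈⟨ -‿distribʳ-* _ _ ⟩
    - (suc m ×′ 1#) * - (suc n ×′ 1#)    ∎
  ι-* -[1+ m ] (ℤ.+ n)  =
    trans (ι-◃⁻ (suc m ℕ.* n)) (trans (-‿cong (×1-homo-* (suc m) n)) (-‿distribˡ-* _ _))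
  ι-* (ℤ.+ m)  -[1+ n ] =
    trans (ι-◃⁻ (m ℕ.* suc n)) (trans (-‿cong (×1-homo-* m (suc n))) (-‿distribʳ-* _ _))
  ι-* (ℤ.+ m)  (ℤ.+ n)  = trans (ι-◃⁺ (m ℕ.* n)) (×1-homo-* m n)

  ℤ⟶R : ℤ.+-*-rawRing -Raw-AlmostCommutative⟶ fromCommutativeRing R
  ℤ⟶R = record
    { ⟦_⟧ = ι ; +-homo = ι-+ ; *-homo = ι-* ; -‿homo = ι-neg ; 0-homo = refl ; 1-homo = refl }

  ι-≟ : ∀ i j → Maybe (ι i ≈ ι j)
  ι-≟ i j with i ℤ.≟ j
  ... | yes i≡j = just (reflexive (≡.cong ι i≡j))
  ... | no _    = nothing

  open import Algebra.Solver.Ring ℤ.+-*-rawRing (fromCommutativeRing R) ℤ⟶R ι-≟ public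

  :0 :1 : ∀ {n} → Polynomial n
  :0 = con (ℤ.+ 0)
  :1 = con (ℤ.+ 1)

module OrderedFieldProperties (F : OrderedField) where
  open OrderedField F
  open ≡ using (refl; sym; trans; cong; cong₂; subst; subst₂; module ≡-Reasoning)

  commutativeRing : CommutativeRing 0ℓ 0ℓ
  commutativeRing = record { isCommutativeRing = isCommutativeRing }

  open CommutativeRing commutativeRing public
    using (+-assoc; +-comm; +-identityˡ; +-identityʳ; -‿inverseʳ;
           *-assoc; *-comm; *-identityˡ; *-identityʳ; zeroˡ; zeroʳ; distribˡ)
  open CommutativeRing commutativeRing using (*-commutativeSemigroup)
  open import Algebra.Properties.CommutativeSemigroup *-commutativeSemigroup public
    using () renaming (x∙yz≈y∙xz to x*yz≡y*xz)
  open IntegerCoefficients commutativeRing public using (solve; _:=_; _:+_; _:-_; _:*_; :0; :1)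
  open RS.IsStrictTotalOrder isStrictTotalOrder public
    using (compare; irrefl) renaming (trans to <-trans)

  infixl 7 _/_
  _/_ : Carrier → Carrier → Carrier
  x / y = x * y ⁻¹

  fromℕ-+ : ∀ m n → fromℕ (m ℕ.+ n) ≡ fromℕ m + fromℕ n
  fromℕ-+ zero    n = sym (+-identityˡ _)
  fromℕ-+ (suc m) n = trans (cong (1# +_) (fromℕ-+ m n)) (sym (+-assoc _ _ _))

  ^-+ : ∀ x m n → x ^ (m ℕ.+ n) ≡ x ^ m * x ^ n
  ^-+ x zero    n = sym (*-identityˡ _)
  ^-+ x (suc m) n = trans (cong (x *_) (^-+ x m n)) (sym (*-assoc _ _ _))

  ⁻¹-≢0 : ∀ {x} → x ≢ 0# → x ⁻¹ ≢ 0#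
  ⁻¹-≢0 {x} x≢0 x⁻¹≡0 = 0≢1 (begin
    0#          ≡⟨ sym (zeroʳ x) ⟩
    x * 0#      ≡⟨ cong (x *_) x⁻¹≡0 ⟨
    x * x ⁻¹    ≡⟨ ⁻¹-inverse x x≢0 ⟩
    1#          ∎)
    where open ≡-Reasoning

  /-cancel : ∀ {x} → x ≢ 0# → x / x ≡ 1#
  /-cancel {x} = ⁻¹-inverse x

  /-*-cancel : ∀ x {y} → y ≢ 0# → x / y * y ≡ x
  /-*-cancel x {y} y≢0 = begin
    x * y ⁻¹ * y     ≡⟨ solve 3 (λ x y y' → x :* y' :* y := x :* (y :* y')) refl x y (y ⁻¹) ⟩
    x * (y / y)      ≡⟨ cong (x *_) (/-cancel y≢0) ⟩
    x * 1#           ≡⟨ *-identityʳ x ⟩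
    x                ∎
    where open ≡-Reasoning

  *-≢0 : ∀ {x y} → x ≢ 0# → y ≢ 0# → x * y ≢ 0#
  *-≢0 {x} {y} x≢0 y≢0 xy≡0 = y≢0 (begin
    y                    ≡⟨ /-*-cancel y x≢0 ⟨
    y / x * x            ≡⟨ solve 3 (λ x y x' → y :* x' :* x := x :* y :* x') refl x y (x ⁻¹) ⟩
    x * y * x ⁻¹         ≡⟨ cong (_* x ⁻¹) xy≡0 ⟩
    0# * x ⁻¹            ≡⟨ zeroˡ _ ⟩
    0#                   ∎)
    where open ≡-Reasoning

  ⁻¹-unique : ∀ {x y} → x ≢ 0# → x * y ≡ 1# → y ≡ x ⁻¹
  ⁻¹-unique {x} {y} x≢0 xy≡1 = begin
    y                ≡⟨ /-*-cancel y x≢0 ⟨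
    y / x * x        ≡⟨ solve 3 (λ x y x' → y :* x' :* x := x :* y :* x') refl x y (x ⁻¹) ⟩
    x * y * x ⁻¹     ≡⟨ cong (_* x ⁻¹) xy≡1 ⟩
    1# * x ⁻¹        ≡⟨ *-identityˡ _ ⟩
    x ⁻¹             ∎
    where open ≡-Reasoning

  ⁻¹-* : ∀ {x y} → x ≢ 0# → y ≢ 0# → (x * y) ⁻¹ ≡ x ⁻¹ * y ⁻¹
  ⁻¹-* {x} {y} x≢0 y≢0 = sym (⁻¹-unique (*-≢0 x≢0 y≢0) (begin
    x * y * (x ⁻¹ * y ⁻¹)   ≡⟨ solve 4 (λ x y x' y' → x :* y :* (x' :* y') := x :* x' :* (y :* y'))
                                     refl x y (x ⁻¹) (y ⁻¹) ⟩
    x / x * (y / y)         ≡⟨ cong₂ _*_ (/-cancel x≢0) (/-cancel y≢0) ⟩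
    1# * 1#                 ≡⟨ *-identityˡ 1# ⟩
    1#                      ∎))
    where open ≡-Reasoning

  1⁻¹ : 1# ⁻¹ ≡ 1#
  1⁻¹ = sym (⁻¹-unique (λ 1≡0 → 0≢1 (sym 1≡0)) (*-identityˡ 1#))

  /-⁻¹ : ∀ {x y} → x ≢ 0# → y ≢ 0# → (x / y) ⁻¹ ≡ y / x
  /-⁻¹ {x} {y} x≢0 y≢0 = sym (⁻¹-unique (*-≢0 x≢0 (⁻¹-≢0 y≢0)) (begin
    x * y ⁻¹ * (y * x ⁻¹)   ≡⟨ solve 4 (λ x y x' y' → x :* y' :* (y :* x') := x :* x' :* (y :* y'))
                                     refl x y (x ⁻¹) (y ⁻¹) ⟩
    x / x * (y / y)         ≡⟨ cong₂ _*_ (/-cancel x≢0) (/-cancel y≢0) ⟩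
    1# * 1#                 ≡⟨ *-identityˡ 1# ⟩
    1#                      ∎))
    where open ≡-Reasoning

  /-cancelʳ : ∀ x {y z} → y ≢ 0# → z ≢ 0# → (x * z) / (y * z) ≡ x / y
  /-cancelʳ x {y} {z} y≢0 z≢0 = begin
    x * z * (y * z) ⁻¹        ≡⟨ cong (x * z *_) (⁻¹-* y≢0 z≢0) ⟩
    x * z * (y ⁻¹ * z ⁻¹)     ≡⟨ solve 4 (λ x z y' z' → x :* z :* (y' :* z') := x :* y' :* (z :* z'))
                                       refl x z (y ⁻¹) (z ⁻¹) ⟩
    x / y * (z / z)           ≡⟨ cong (x / y *_) (/-cancel z≢0) ⟩
    x / y * 1#                ≡⟨ *-identityʳ _ ⟩
    x / y                     ∎
    where open ≡-Reasoning

  weighted-mean : ∀ x y u v → y + x ≢ 0# → (y * u + x * v) / (y + x) ≡ u + x / (y + x) * (v - u)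
  weighted-mean x y u v d≢0 = begin
    (y * u + x * v) / (y + x)
      ≡⟨ solve 5 (λ x y u v d' → (y :* u :+ x :* v) :* d' := u :* ((y :+ x) :* d') :+ x :* d' :* (v :- u))
               refl x y u v ((y + x) ⁻¹) ⟩
    u * ((y + x) / (y + x)) + x / (y + x) * (v - u)
      ≡⟨ cong (λ z → u * z + x / (y + x) * (v - u)) (/-cancel d≢0) ⟩
    u * 1# + x / (y + x) * (v - u)
      ≡⟨ cong (_+ x / (y + x) * (v - u)) (*-identityʳ u) ⟩
    u + x / (y + x) * (v - u) ∎
    where open ≡-Reasoning

  0<⇒≢0 : ∀ {x} → 0# < x → x ≢ 0#
  0<⇒≢0 0<x x≡0 = irrefl (sym x≡0) 0<x

  <⇒0<- : ∀ {x y} → x < y → 0# < y - x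
  <⇒0<- {x} x<y = subst (_< _) (-‿inverseʳ x) (+-mono-< (- x) x<y)

  0<-⇒< : ∀ {x y} → 0# < y - x → x < y
  0<-⇒< {x} {y} 0<y-x = subst₂ _<_ (+-identityˡ x) (solve 2 (λ x y → y :- x :+ x := y) refl x y)
    (+-mono-< x 0<y-x)

  0<+ : ∀ {x y} → 0# < x → 0# < y → 0# < x + y
  0<+ {x} {y} 0<x 0<y = <-trans 0<y (subst (_< x + y) (+-identityˡ y) (+-mono-< y 0<x))

  0≤+0< : ∀ {x y} → 0# ≤ x → 0# < y → 0# < x + y
  0≤+0< (inj₁ 0<x) 0<y = 0<+ 0<x 0<y
  0≤+0< {y = y} (inj₂ refl) 0<y = subst (0# <_) (sym (+-identityˡ y)) 0<y

  0<+0≤ : ∀ {x y} → 0# < x → 0# ≤ y → 0# < x + y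
  0<+0≤ {x} {y} 0<x 0≤y = subst (0# <_) (+-comm y x) (0≤+0< 0≤y 0<x)

  0≤* : ∀ {x y} → 0# ≤ x → 0# ≤ y → 0# ≤ x * y
  0≤* (inj₁ 0<x)        (inj₁ 0<y)  = inj₁ (*-pos 0<x 0<y)
  0≤* {x} (inj₁ _)      (inj₂ refl) = inj₂ (sym (zeroʳ x))
  0≤* {y = y} (inj₂ refl) _         = inj₂ (sym (zeroˡ y))

  0<1 : 0# < 1#
  0<1 with compare 0# 1#
  ... | tri< 0<1 _ _ = 0<1
  ... | tri≈ _ 0≡1 _ = ⊥-elim (0≢1 0≡1)
  ... | tri> _ _ 1<0 = ⊥-elim (irrefl refl (<-trans 1<0 (subst (0# <_) [0-1]²≡1 (*-pos 0<0-1 0<0-1))))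
    where
      0<0-1 : 0# < 0# - 1#
      0<0-1 = <⇒0<- 1<0
      [0-1]²≡1 : (0# - 1#) * (0# - 1#) ≡ 1#
      [0-1]²≡1 = solve 0 ((:0 :- :1) :* (:0 :- :1) := :1) refl

  0<⁻¹ : ∀ {x} → 0# < x → 0# < x ⁻¹
  0<⁻¹ {x} 0<x with compare 0# (x ⁻¹)
  ... | tri< 0<x⁻¹ _ _ = 0<x⁻¹
  ... | tri≈ _ 0≡x⁻¹ _ = ⊥-elim (⁻¹-≢0 (0<⇒≢0 0<x) (sym 0≡x⁻¹))
  ... | tri> _ _ x⁻¹<0 = ⊥-elim (irrefl refl (subst (0# <_) 1+x[0-x⁻¹]≡0 (0<+ 0<1 (*-pos 0<x (<⇒0<- x⁻¹<0)))))
    where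
      1+x[0-x⁻¹]≡0 : 1# + x * (0# - x ⁻¹) ≡ 0#
      1+x[0-x⁻¹]≡0 = begin
        1# + x * (0# - x ⁻¹)   ≡⟨ solve 2 (λ x x' → :1 :+ x :* (:0 :- x') := :1 :- x :* x') refl x (x ⁻¹) ⟩
        1# - x / x             ≡⟨ cong (λ y → 1# - y) (/-cancel (0<⇒≢0 0<x)) ⟩
        1# - 1#                ≡⟨ -‿inverseʳ 1# ⟩
        0#                     ∎
        where open ≡-Reasoning

  ∑ : {A : Set} → (A → Carrier) → List A → Carrier
  ∑ f xs = Σ[ map f xs ]

  ∑-cong : ∀ {A : Set} {f g : A → Carrier} → (∀ x → f x ≡ g x) → ∀ xs → ∑ f xs ≡ ∑ g xs
  ∑-cong f≗g xs = cong Σ[_] (map-cong f≗g xs)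

  ∑-++ : ∀ {A : Set} (f : A → Carrier) xs ys → ∑ f (xs ++ ys) ≡ ∑ f xs + ∑ f ys
  ∑-++ f []       ys = sym (+-identityˡ _)
  ∑-++ f (x ∷ xs) ys = trans (cong (f x +_) (∑-++ f xs ys)) (sym (+-assoc _ _ _))

  ∑-+ : ∀ {A : Set} (f g : A → Carrier) xs → ∑ (λ x → f x + g x) xs ≡ ∑ f xs + ∑ g xs
  ∑-+ f g []       = sym (+-identityˡ 0#)
  ∑-+ f g (x ∷ xs) = trans (cong (f x + g x +_) (∑-+ f g xs))
    (solve 4 (λ a b c d → a :+ b :+ (c :+ d) := a :+ c :+ (b :+ d)) refl (f x) (g x) (∑ f xs) (∑ g xs))

  ∑-*ˡ : ∀ {A : Set} c (f : A → Carrier) xs → ∑ (λ x → c * f x) xs ≡ c * ∑ f xs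
  ∑-*ˡ c f []       = sym (zeroʳ c)
  ∑-*ˡ c f (x ∷ xs) = trans (cong (c * f x +_) (∑-*ˡ c f xs)) (sym (distribˡ c _ _))

  ∑-*ʳ : ∀ {A : Set} c (f : A → Carrier) xs → ∑ (λ x → f x * c) xs ≡ ∑ f xs * c
  ∑-*ʳ c f xs = trans (∑-cong (λ x → *-comm (f x) c) xs) (trans (∑-*ˡ c f xs) (*-comm c _))

  ∑-map : ∀ {A B : Set} (f : B → Carrier) (g : A → B) xs → ∑ f (map g xs) ≡ ∑ (λ x → f (g x)) xs
  ∑-map f g xs = cong Σ[_] (sym (map-∘ xs))

  ∑-concatMap : ∀ {A B : Set} (f : B → Carrier) (g : A → List B) xs →
                ∑ f (concatMap g xs) ≡ ∑ (λ x → ∑ f (g x)) xs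
  ∑-concatMap f g []       = refl
  ∑-concatMap f g (x ∷ xs) = trans (∑-++ f (g x) (concatMap g xs)) (cong (∑ f (g x) +_) (∑-concatMap f g xs))

module TreeRecursion (F : OrderedField) (β γ : OrderedField.Carrier F) where
  open OrderedField F
  open OrderedFieldProperties F
  open Gibbs F using (ω)
  open ≡ using (refl; sym; trans; cong; cong₂; subst; module ≡-Reasoning)

  D : Carrier
  D = 1# - β * γ

  -- If P = λ ∏ Rᵢ, then fieldStep P is the effective field of the glued tree, and π₁ P,
  -- π₀ P are the probabilities that u has spin 1 given that ρ has spin 1, resp. 0.
  fieldStep π₁ π₀ : Carrier → Carrier
  fieldStep P = (1# + γ * P) / (β + P)
  π₁ P = γ * P / (1# + γ * P)
  π₀ P = P / (β + P)

  module _ (0≤β : 0# ≤ β) (0≤γ : 0# ≤ γ) {P : Carrier} (0<P : 0# < P) where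

    0<β+P : 0# < β + P
    0<β+P = 0≤+0< 0≤β 0<P

    0<1+γP : 0# < 1# + γ * P
    0<1+γP = 0<+0≤ 0<1 (0≤* 0≤γ (inj₁ 0<P))

    β+P≢0 : β + P ≢ 0#
    β+P≢0 = 0<⇒≢0 0<β+P

    1+γP≢0 : 1# + γ * P ≢ 0#
    1+γP≢0 = 0<⇒≢0 0<1+γP

    fieldStep-γ : fieldStep P - γ ≡ D / (β + P)
    fieldStep-γ = begin
      (1# + γ * P) / (β + P) - γ
        ≡⟨ cong (λ x → fieldStep P - x) (/-*-cancel γ β+P≢0) ⟨
      (1# + γ * P) / (β + P) - γ / (β + P) * (β + P)
        ≡⟨ solve 4 (λ b g p u → (:1 :+ g :* p) :* u :- g :* u :* (b :+ p) := (:1 :- b :* g) :* u)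
                 refl β γ P ((β + P) ⁻¹) ⟩
      D / (β + P) ∎
      where open ≡-Reasoning

    1-βfieldStep : 1# - β * fieldStep P ≡ P * D / (β + P)
    1-βfieldStep = begin
      1# - β * fieldStep P
        ≡⟨ cong (λ x → x - β * fieldStep P) (/-cancel β+P≢0) ⟨
      (β + P) / (β + P) - β * ((1# + γ * P) / (β + P))
        ≡⟨ solve 4 (λ b g p u → (b :+ p) :* u :- b :* ((:1 :+ g :* p) :* u) := p :* (:1 :- b :* g) :* u)
                 refl β γ P ((β + P) ⁻¹) ⟩
      P * D / (β + P) ∎
      where open ≡-Reasoning

    fieldStep⁻¹-β : fieldStep P ⁻¹ - β ≡ P * D / (1# + γ * P)
    fieldStep⁻¹-β = begin
      ((1# + γ * P) / (β + P)) ⁻¹ - β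
        ≡⟨ cong (_- β) (/-⁻¹ 1+γP≢0 β+P≢0) ⟩
      (β + P) / (1# + γ * P) - β
        ≡⟨ cong (λ x → (β + P) / (1# + γ * P) - x) (/-*-cancel β 1+γP≢0) ⟨
      (β + P) / (1# + γ * P) - β / (1# + γ * P) * (1# + γ * P)
        ≡⟨ solve 4 (λ b g p v → (b :+ p) :* v :- b :* v :* (:1 :+ g :* p) := p :* (:1 :- b :* g) :* v)
                 refl β γ P ((1# + γ * P) ⁻¹) ⟩
      P * D / (1# + γ * P) ∎
      where open ≡-Reasoning

    π₀-π₁ : π₀ P - π₁ P ≡ P * D * ((β + P) ⁻¹ * (1# + γ * P) ⁻¹)
    π₀-π₁ = begin
      P * u - γ * P * v
        ≡⟨ cong₂ _-_ (*-identityʳ _) (*-identityʳ _) ⟨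
      P * u * 1# - γ * P * v * 1#
        ≡⟨ cong₂ (λ x y → P * u * x - γ * P * v * y) (/-cancel 1+γP≢0) (/-cancel β+P≢0) ⟨
      P * u * ((1# + γ * P) * v) - γ * P * v * ((β + P) * u)
        ≡⟨ solve 5 (λ b g p u v → p :* u :* ((:1 :+ g :* p) :* v) :- g :* p :* v :* ((b :+ p) :* u)
                                := p :* (:1 :- b :* g) :* (u :* v))
                 refl β γ P u v ⟩
      P * D * (u * v) ∎
      where
        open ≡-Reasoning
        u v : Carrier
        u = (β + P) ⁻¹
        v = (1# + γ * P) ⁻¹

    1-[π₀-π₁] : 1# - (π₀ P - π₁ P) ≡ β / (β + P) + π₁ P
    1-[π₀-π₁] = begin
      1# - (P / (β + P) - π₁ P)
        ≡⟨ cong (λ x → x - (P / (β + P) - π₁ P)) (/-cancel β+P≢0) ⟨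
      (β + P) / (β + P) - (P / (β + P) - π₁ P)
        ≡⟨ solve 4 (λ b p u q → (b :+ p) :* u :- (p :* u :- q) := b :* u :+ q) refl β P ((β + P) ⁻¹) (π₁ P) ⟩
      β / (β + P) + π₁ P ∎
      where open ≡-Reasoning

    γ<fieldStep : β * γ < 1# → γ < fieldStep P
    γ<fieldStep βγ<1 = 0<-⇒< (subst (0# <_) (sym fieldStep-γ) (*-pos (<⇒0<- βγ<1) (0<⁻¹ 0<β+P)))

    fieldStep<β⁻¹ : β * γ < 1# → (β ≡ 0#) ⊎ (fieldStep P < β ⁻¹)
    fieldStep<β⁻¹ βγ<1 = by-sign 0≤β
      where
        open ≡-Reasoning
        R : Carrier
        R = fieldStep P
        0<1-βR : 0# < 1# - β * R
        0<1-βR = subst (0# <_) (sym 1-βfieldStep) (*-pos (*-pos 0<P (<⇒0<- βγ<1)) (0<⁻¹ 0<β+P))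
        β⁻¹-R : β ≢ 0# → β ⁻¹ - R ≡ (1# - β * R) * β ⁻¹
        β⁻¹-R β≢0 = begin
          β ⁻¹ - R             ≡⟨ cong (λ x → β ⁻¹ - x) (trans (cong (R *_) (/-cancel β≢0)) (*-identityʳ R)) ⟨
          β ⁻¹ - R * (β / β)   ≡⟨ solve 3 (λ b b' r → b' :- r :* (b :* b') := (:1 :- b :* r) :* b') refl β (β ⁻¹) R ⟩
          (1# - β * R) * β ⁻¹  ∎
        by-sign : 0# ≤ β → (β ≡ 0#) ⊎ (R < β ⁻¹)
        by-sign (inj₂ 0≡β) = inj₁ (sym 0≡β)
        by-sign (inj₁ 0<β) = inj₂ (0<-⇒< (subst (0# <_) (sym (β⁻¹-R (0<⇒≢0 0<β))) (*-pos 0<1-βR (0<⁻¹ 0<β))))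

    module _ (βγ<1 : β * γ < 1#) where

      ω-fieldStep : ω β γ (fieldStep P) ≡ π₀ P - π₁ P
      ω-fieldStep = begin
        (1# + β * γ - β * R - γ * R ⁻¹) / D
          ≡⟨ cong (_/ D) (solve 4 (λ b g r r' → :1 :+ b :* g :- b :* r :- g :* r'
                                               := :1 :- b :* r :- g :* (r' :- b)) refl β γ R (R ⁻¹)) ⟩
        (1# - β * R - γ * (R ⁻¹ - β)) / D
          ≡⟨ cong₂ (λ x y → (x - γ * y) / D) 1-βfieldStep fieldStep⁻¹-β ⟩
        (P * D / (β + P) - γ * (P * D / (1# + γ * P))) / D
          ≡⟨ solve 6 (λ g p d d' u v → (p :* d :* u :- g :* (p :* d :* v)) :* d'
                                      := (p :* u :- g :* p :* v) :* (d :* d')) refl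
               γ P D (D ⁻¹) ((β + P) ⁻¹) ((1# + γ * P) ⁻¹) ⟩
        (π₀ P - π₁ P) * (D / D)
          ≡⟨ cong ((π₀ P - π₁ P) *_) (/-cancel (0<⇒≢0 (<⇒0<- βγ<1))) ⟩
        (π₀ P - π₁ P) * 1#
          ≡⟨ *-identityʳ _ ⟩
        π₀ P - π₁ P ∎
        where
          open ≡-Reasoning
          R : Carrier
          R = fieldStep P

      0<ω : 0# < ω β γ (fieldStep P)
      0<ω = subst (0# <_) (sym (trans ω-fieldStep π₀-π₁))
        (*-pos (*-pos 0<P (<⇒0<- βγ<1)) (*-pos (0<⁻¹ 0<β+P) (0<⁻¹ 0<1+γP)))

      ω<1 : ¬ ((β ≡ 0#) × (γ ≡ 0#)) → ω β γ (fieldStep P) < 1#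
      ω<1 ¬β≡0≡γ = 0<-⇒< (subst (0# <_) (sym (trans (cong (λ x → 1# - x) ω-fieldStep) 1-[π₀-π₁]))
                                        (0<β/[β+P]+π₁ 0≤β 0≤γ))
        where
          0<π₁ : 0# < γ → 0# < π₁ P
          0<π₁ 0<γ = *-pos (*-pos 0<γ 0<P) (0<⁻¹ 0<1+γP)
          0<β/[β+P]+π₁ : 0# ≤ β → 0# ≤ γ → 0# < β / (β + P) + π₁ P
          0<β/[β+P]+π₁ (inj₁ 0<β) _          =
            0<+0≤ (*-pos 0<β (0<⁻¹ 0<β+P)) (0≤* (0≤* 0≤γ (inj₁ 0<P)) (inj₁ (0<⁻¹ 0<1+γP)))
          0<β/[β+P]+π₁ (inj₂ 0≡β) (inj₁ 0<γ) = 0≤+0< (0≤* 0≤β (inj₁ (0<⁻¹ 0<β+P))) (0<π₁ 0<γ)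
          0<β/[β+P]+π₁ (inj₂ 0≡β) (inj₂ 0≡γ) = ⊥-elim (¬β≡0≡γ (sym 0≡β , sym 0≡γ))

module PartitionFunctions (F : OrderedField) (β γ λ' : OrderedField.Carrier F) where
  open OrderedField F
  open OrderedFieldProperties F
  open Gibbs F
  open TreeRecursion F β γ using (fieldStep; π₁; π₀; 0<β+P; 0<1+γP)
  open ≡ using (refl; sym; trans; cong; cong₂; subst; module ≡-Reasoning)

  edge : Bool → Bool → Carrier
  edge p q = β ^ both0 p q * γ ^ both1 p q

  -- weight of a configuration of the subtrees ts hanging below a vertex of spin p:
  -- the edges to that vertex are counted, the vertex itself is not
  forestWeight : ∀ {ts} → Bool → Confs ts → Carrier
  forestWeight p cs = λ' ^ sizes cs * β ^ m0s p cs * γ ^ m1s p cs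

  forestZ forestSizeSum : Bool → List Tree → Carrier
  forestZ p ts       = ∑ (forestWeight p) (allConfs ts)
  forestSizeSum p ts = ∑ (λ cs → fromℕ (sizes cs) * forestWeight p cs) (allConfs ts)

  hangingZ hangingSizeSum : Bool → Tree → Carrier
  hangingZ p t       = ∑ (λ c → edge p (rootSpin c) * weight β γ λ' t c) (allConf t)
  hangingSizeSum p t = ∑ (λ c → fromℕ (size c) * (edge p (rootSpin c) * weight β γ λ' t c)) (allConf t)

  rootZ rootSizeSum : Bool → List Tree → Carrier
  rootZ s ds       = ∑ (λ cs → weight β γ λ' (node ds) (cnode s cs)) (allConfs ds)
  rootSizeSum s ds = ∑ (λ cs → fromℕ (size (cnode s cs)) * weight β γ λ' (node ds) (cnode s cs)) (allConfs ds)

  forestWeight-∷ : ∀ {t ts} p (c : Conf t) (cs : Confs ts) →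
                   forestWeight p (c ∷ cs) ≡ edge p (rootSpin c) * weight β γ λ' t c * forestWeight p cs
  forestWeight-∷ p c cs = begin
    λ' ^ (size c ℕ.+ sizes cs) * β ^ (e₀ ℕ.+ m0 c ℕ.+ m0s p cs) * γ ^ (e₁ ℕ.+ m1 c ℕ.+ m1s p cs)
      ≡⟨ cong₂ _*_ (cong₂ _*_ (^-+ λ' (size c) (sizes cs))
                              (trans (^-+ β (e₀ ℕ.+ m0 c) (m0s p cs)) (cong (_* _) (^-+ β e₀ (m0 c)))))
                   (trans (^-+ γ (e₁ ℕ.+ m1 c) (m1s p cs)) (cong (_* _) (^-+ γ e₁ (m1 c)))) ⟩
    λ' ^ size c * λ' ^ sizes cs * (β ^ e₀ * β ^ m0 c * β ^ m0s p cs) * (γ ^ e₁ * γ ^ m1 c * γ ^ m1s p cs)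
      ≡⟨ solve 8 (λ l l' b₀ b b' g₀ g g' → l :* l' :* (b₀ :* b :* b') :* (g₀ :* g :* g')
                                         := b₀ :* g₀ :* (l :* b :* g) :* (l' :* b' :* g')) refl
           (λ' ^ size c) (λ' ^ sizes cs) (β ^ e₀) (β ^ m0 c) (β ^ m0s p cs) (γ ^ e₁) (γ ^ m1 c) (γ ^ m1s p cs) ⟩
    edge p (rootSpin c) * weight β γ λ' _ c * forestWeight p cs ∎
    where
      open ≡-Reasoning
      e₀ e₁ : ℕ
      e₀ = both0 p (rootSpin c)
      e₁ = both1 p (rootSpin c)

  ∑-allConfs-∷ : ∀ {t ts} {h : Confs (t ∷ ts) → Carrier} (k : Conf t → Confs ts → Carrier) →
                 (∀ c cs → h (c ∷ cs) ≡ k c cs) →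
                 ∑ h (allConfs (t ∷ ts)) ≡ ∑ (λ c → ∑ (k c) (allConfs ts)) (allConf t)
  ∑-allConfs-∷ {t} {ts} {h} k h≗k = begin
    ∑ h (concatMap (λ c → map (c ∷_) (allConfs ts)) (allConf t))
      ≡⟨ ∑-concatMap h _ (allConf t) ⟩
    ∑ (λ c → ∑ h (map (c ∷_) (allConfs ts))) (allConf t)
      ≡⟨ ∑-cong (λ c → trans (∑-map h (c ∷_) (allConfs ts)) (∑-cong (h≗k c) (allConfs ts))) (allConf t) ⟩
    ∑ (λ c → ∑ (k c) (allConfs ts)) (allConf t) ∎
    where open ≡-Reasoning

  ∑-allConf-node : ∀ ds (f : Conf (node ds) → Carrier) →
                   ∑ f (allConf (node ds))
                     ≡ ∑ (λ cs → f (cnode true cs)) (allConfs ds) + ∑ (λ cs → f (cnode false cs)) (allConfs ds)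
  ∑-allConf-node ds f = trans (∑-concatMap f (λ s → map (cnode s) (allConfs ds)) (true ∷ false ∷ []))
    (cong₂ _+_ (∑-map f (cnode true) (allConfs ds)) (trans (+-identityʳ _) (∑-map f (cnode false) (allConfs ds))))

  ∑∑-* : ∀ {A B : Set} (f : A → Carrier) (g : B → Carrier) xs ys →
         ∑ (λ x → ∑ (λ y → f x * g y) ys) xs ≡ ∑ f xs * ∑ g ys
  ∑∑-* f g xs ys = trans (∑-cong (λ x → ∑-*ˡ (f x) g ys) xs) (∑-*ʳ (∑ g ys) f xs)

  forestZ-∷ : ∀ p t ts → forestZ p (t ∷ ts) ≡ hangingZ p t * forestZ p ts
  forestZ-∷ p t ts = trans (∑-allConfs-∷ (λ c cs → x c * forestWeight p cs) (forestWeight-∷ p))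
                           (∑∑-* x (forestWeight p) (allConf t) (allConfs ts))
    where
      x : Conf t → Carrier
      x c = edge p (rootSpin c) * weight β γ λ' t c

  forestSizeSum-∷ : ∀ p t ts →
    forestSizeSum p (t ∷ ts) ≡ hangingSizeSum p t * forestZ p ts + hangingZ p t * forestSizeSum p ts
  forestSizeSum-∷ p t ts = begin
    forestSizeSum p (t ∷ ts)
      ≡⟨ ∑-allConfs-∷ (λ c cs → y c * w cs + x c * v cs) split ⟩
    ∑ (λ c → ∑ (λ cs → y c * w cs + x c * v cs) (allConfs ts)) (allConf t)
      ≡⟨ ∑-cong (λ c → ∑-+ (λ cs → y c * w cs) (λ cs → x c * v cs) (allConfs ts)) (allConf t) ⟩
    ∑ (λ c → ∑ (λ cs → y c * w cs) (allConfs ts) + ∑ (λ cs → x c * v cs) (allConfs ts)) (allConf t)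
      ≡⟨ ∑-+ _ _ (allConf t) ⟩
    ∑ (λ c → ∑ (λ cs → y c * w cs) (allConfs ts)) (allConf t)
      + ∑ (λ c → ∑ (λ cs → x c * v cs) (allConfs ts)) (allConf t)
      ≡⟨ cong₂ _+_ (∑∑-* y w (allConf t) (allConfs ts)) (∑∑-* x v (allConf t) (allConfs ts)) ⟩
    hangingSizeSum p t * forestZ p ts + hangingZ p t * forestSizeSum p ts ∎
    where
      open ≡-Reasoning
      x y : Conf t → Carrier
      x c = edge p (rootSpin c) * weight β γ λ' t c
      y c = fromℕ (size c) * x c
      w v : ∀ {us} → Confs us → Carrier
      w = forestWeight p
      v cs = fromℕ (sizes cs) * w cs
      split : ∀ c cs → v (c ∷ cs) ≡ y c * w cs + x c * v cs
      split c cs = trans (cong₂ _*_ (fromℕ-+ (size c) (sizes cs)) (forestWeight-∷ p c cs))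
        (solve 4 (λ n n' z u → (n :+ n') :* (z :* u) := n :* z :* u :+ z :* (n' :* u)) refl
          (fromℕ (size c)) (fromℕ (sizes cs)) (x c) (w cs))

  rootZ-true : ∀ ds → rootZ true ds ≡ λ' * forestZ true ds
  rootZ-true ds = trans (∑-cong (λ cs → solve 4 (λ l l' b g → l :* l' :* b :* g := l :* (l' :* b :* g)) refl
                                          λ' (λ' ^ sizes cs) (β ^ m0s true cs) (γ ^ m1s true cs)) (allConfs ds))
                        (∑-*ˡ λ' (forestWeight true) (allConfs ds))

  rootSizeSum-true : ∀ ds → rootSizeSum true ds ≡ λ' * (forestZ true ds + forestSizeSum true ds)
  rootSizeSum-true ds = begin
    rootSizeSum true ds
      ≡⟨ ∑-cong (λ cs → solve 5 (λ n l l' b g → (:1 :+ n) :* (l :* l' :* b :* g)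
                                               := l :* (l' :* b :* g :+ n :* (l' :* b :* g))) refl
                          (fromℕ (sizes cs)) λ' (λ' ^ sizes cs) (β ^ m0s true cs) (γ ^ m1s true cs)) (allConfs ds) ⟩
    ∑ (λ cs → λ' * (forestWeight true cs + fromℕ (sizes cs) * forestWeight true cs)) (allConfs ds)
      ≡⟨ ∑-*ˡ λ' _ (allConfs ds) ⟩
    λ' * ∑ (λ cs → forestWeight true cs + fromℕ (sizes cs) * forestWeight true cs) (allConfs ds)
      ≡⟨ cong (λ' *_) (∑-+ (forestWeight true) _ (allConfs ds)) ⟩
    λ' * (forestZ true ds + forestSizeSum true ds) ∎
    where open ≡-Reasoning

  hangingZ-node : ∀ p ds →
    hangingZ p (node ds) ≡ edge p true * (λ' * forestZ true ds) + edge p false * forestZ false ds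
  hangingZ-node p ds = trans (∑-allConf-node ds _)
    (cong₂ _+_ (trans (∑-*ˡ (edge p true) _ (allConfs ds)) (cong (edge p true *_) (rootZ-true ds)))
               (∑-*ˡ (edge p false) _ (allConfs ds)))

  hangingZ-true : ∀ ds → hangingZ true (node ds) ≡ γ * (λ' * forestZ true ds) + forestZ false ds
  hangingZ-true ds = trans (hangingZ-node true ds)
    (solve 3 (λ g a b → :1 :* (g :* :1) :* a :+ :1 :* :1 :* b := g :* a :+ b) refl
       γ (λ' * forestZ true ds) (forestZ false ds))

  hangingZ-false : ∀ ds → hangingZ false (node ds) ≡ λ' * forestZ true ds + β * forestZ false ds
  hangingZ-false ds = trans (hangingZ-node false ds)
    (solve 3 (λ b' a b → :1 :* :1 :* a :+ b' :* :1 :* :1 :* b := a :+ b' :* b) refl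
       β (λ' * forestZ true ds) (forestZ false ds))

  hangingSizeSum-node : ∀ p ds →
    hangingSizeSum p (node ds)
      ≡ edge p true * (λ' * (forestZ true ds + forestSizeSum true ds)) + edge p false * forestSizeSum false ds
  hangingSizeSum-node p ds = trans (∑-allConf-node ds _)
    (cong₂ _+_ (trans (∑-cong (λ cs → x*yz≡y*xz (fromℕ (size (cnode true cs))) (edge p true) _) (allConfs ds))
                      (trans (∑-*ˡ (edge p true) _ (allConfs ds)) (cong (edge p true *_) (rootSizeSum-true ds))))
               (trans (∑-cong (λ cs → x*yz≡y*xz (fromℕ (size (cnode false cs))) (edge p false) _) (allConfs ds))
                      (∑-*ˡ (edge p false) _ (allConfs ds))))

  hangingSizeSum-true : ∀ ds →
    hangingSizeSum true (node ds) ≡ γ * (λ' * (forestZ true ds + forestSizeSum true ds)) + forestSizeSum false ds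
  hangingSizeSum-true ds = trans (hangingSizeSum-node true ds)
    (solve 3 (λ g a b → :1 :* (g :* :1) :* a :+ :1 :* :1 :* b := g :* a :+ b) refl
       γ (λ' * (forestZ true ds + forestSizeSum true ds)) (forestSizeSum false ds))

  hangingSizeSum-false : ∀ ds →
    hangingSizeSum false (node ds) ≡ λ' * (forestZ true ds + forestSizeSum true ds) + β * forestSizeSum false ds
  hangingSizeSum-false ds = trans (hangingSizeSum-node false ds)
    (solve 3 (λ b' a b → :1 :* :1 :* a :+ b' :* :1 :* :1 :* b := a :+ b' :* b) refl
       β (λ' * (forestZ true ds + forestSizeSum true ds)) (forestSizeSum false ds))

  Z-node : ∀ ds → Z β γ λ' (node ds) ≡ rootZ true ds + rootZ false ds
  Z-node ds = ∑-allConf-node ds (weight β γ λ' (node ds))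

  ∑-root≡ : ∀ ds s (f : Conf (node ds) → Carrier) →
            ∑ (λ σ → [root≡_] β γ λ' (node ds) s σ * f σ) (allConf (node ds))
              ≡ ∑ (λ cs → f (cnode s cs)) (allConfs ds)
  ∑-root≡ ds true  f = trans (∑-allConf-node ds _)
    (trans (cong₂ _+_ (∑-*ˡ 1# _ (allConfs ds)) (∑-*ˡ 0# _ (allConfs ds)))
           (solve 2 (λ x y → :1 :* x :+ :0 :* y := x) refl _ _))
  ∑-root≡ ds false f = trans (∑-allConf-node ds _)
    (trans (cong₂ _+_ (∑-*ˡ 0# _ (allConfs ds)) (∑-*ˡ 1# _ (allConfs ds)))
           (solve 2 (λ x y → :0 :* x :+ :1 :* y := y) refl _ _))

  Prob-root-node : ∀ ds s → Prob-root β γ λ' (node ds) s ≡ rootZ s ds / Z β γ λ' (node ds)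
  Prob-root-node ds s = trans (∑-root≡ ds s (μ β γ λ' (node ds)))
                              (∑-*ʳ (Z β γ λ' (node ds) ⁻¹) _ (allConfs ds))

  conditionalSizeSum-node : ∀ ds s →
    ∑ (λ σ → fromℕ (size σ) * ([root≡_] β γ λ' (node ds) s σ * μ β γ λ' (node ds) σ)) (allConf (node ds))
      ≡ rootSizeSum s ds / Z β γ λ' (node ds)
  conditionalSizeSum-node ds s = begin
    _  ≡⟨ ∑-cong (λ σ → x*yz≡y*xz (fromℕ (size σ)) _ _) (allConf (node ds)) ⟩
    _  ≡⟨ ∑-root≡ ds s (λ σ → fromℕ (size σ) * μ β γ λ' (node ds) σ) ⟩
    _  ≡⟨ ∑-cong (λ cs → sym (*-assoc _ _ _)) (allConfs ds) ⟩
    _  ≡⟨ ∑-*ʳ (Z β γ λ' (node ds) ⁻¹) _ (allConfs ds) ⟩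
    rootSizeSum s ds / Z β γ λ' (node ds) ∎
    where open ≡-Reasoning

  forestZ-[] : ∀ p → forestZ p [] ≡ 1#
  forestZ-[] p = trans (+-identityʳ _) (trans (*-identityʳ _) (*-identityʳ _))

  forestSizeSum-[] : ∀ p → forestSizeSum p [] ≡ 0#
  forestSizeSum-[] p = trans (+-identityʳ _) (zeroˡ _)

  forestZ-++ : ∀ p ts us → forestZ p (ts ++ us) ≡ forestZ p ts * forestZ p us
  forestZ-++ p []       us = sym (trans (cong (_* forestZ p us) (forestZ-[] p)) (*-identityˡ _))
  forestZ-++ p (t ∷ ts) us = begin
    forestZ p (t ∷ ts ++ us)                      ≡⟨ forestZ-∷ p t (ts ++ us) ⟩
    hangingZ p t * forestZ p (ts ++ us)           ≡⟨ cong (hangingZ p t *_) (forestZ-++ p ts us) ⟩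
    hangingZ p t * (forestZ p ts * forestZ p us)  ≡⟨ *-assoc _ _ _ ⟨
    hangingZ p t * forestZ p ts * forestZ p us    ≡⟨ cong (_* forestZ p us) (forestZ-∷ p t ts) ⟨
    forestZ p (t ∷ ts) * forestZ p us             ∎
    where open ≡-Reasoning

  forestSizeSum-++ : ∀ p ts us →
    forestSizeSum p (ts ++ us) ≡ forestSizeSum p ts * forestZ p us + forestZ p ts * forestSizeSum p us
  forestSizeSum-++ p [] us = sym (begin
    forestSizeSum p [] * forestZ p us + forestZ p [] * forestSizeSum p us
      ≡⟨ cong₂ (λ v z → v * forestZ p us + z * forestSizeSum p us) (forestSizeSum-[] p) (forestZ-[] p) ⟩
    0# * forestZ p us + 1# * forestSizeSum p us
      ≡⟨ solve 2 (λ z v → :0 :* z :+ :1 :* v := v) refl (forestZ p us) (forestSizeSum p us) ⟩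
    forestSizeSum p us ∎)
    where open ≡-Reasoning
  forestSizeSum-++ p (t ∷ ts) us = begin
    forestSizeSum p (t ∷ ts ++ us)
      ≡⟨ forestSizeSum-∷ p t (ts ++ us) ⟩
    y * forestZ p (ts ++ us) + x * forestSizeSum p (ts ++ us)
      ≡⟨ cong₂ (λ z v → y * z + x * v) (forestZ-++ p ts us) (forestSizeSum-++ p ts us) ⟩
    y * (z₁ * z₂) + x * (v₁ * z₂ + z₁ * v₂)
      ≡⟨ solve 6 (λ y x z₁ z₂ v₁ v₂ → y :* (z₁ :* z₂) :+ x :* (v₁ :* z₂ :+ z₁ :* v₂)
                                   := (y :* z₁ :+ x :* v₁) :* z₂ :+ x :* z₁ :* v₂) refl y x z₁ z₂ v₁ v₂ ⟩
    (y * z₁ + x * v₁) * z₂ + x * z₁ * v₂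
      ≡⟨ cong₂ (λ v z → v * z₂ + z * v₂) (forestSizeSum-∷ p t ts) (forestZ-∷ p t ts) ⟨
    forestSizeSum p (t ∷ ts) * z₂ + forestZ p (t ∷ ts) * v₂ ∎
    where
      open ≡-Reasoning
      x y z₁ z₂ v₁ v₂ : Carrier
      x = hangingZ p t
      y = hangingSizeSum p t
      z₁ = forestZ p ts
      z₂ = forestZ p us
      v₁ = forestSizeSum p ts
      v₂ = forestSizeSum p us

  forestZ-[_] : ∀ {p} t → forestZ p (t ∷ []) ≡ hangingZ p t
  forestZ-[_] {p} t = trans (forestZ-∷ p t []) (trans (cong (hangingZ p t *_) (forestZ-[] p)) (*-identityʳ _))

  forestSizeSum-[_] : ∀ {p} t → forestSizeSum p (t ∷ []) ≡ hangingSizeSum p t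
  forestSizeSum-[_] {p} t = trans (forestSizeSum-∷ p t [])
    (trans (cong₂ (λ z v → hangingSizeSum p t * z + hangingZ p t * v) (forestZ-[] p) (forestSizeSum-[] p))
           (solve 2 (λ y x → y :* :1 :+ x :* :0 := y) refl (hangingSizeSum p t) (hangingZ p t)))

  forestField : List Tree → Carrier
  forestField ts = forestZ true ts / forestZ false ts

  meanSize : Bool → List Tree → Carrier
  meanSize p ts = forestSizeSum p ts / forestZ p ts

  forestGap : List Tree → Carrier
  forestGap ts = meanSize true ts - meanSize false ts

  module Positive (0≤β : 0# ≤ β) (0≤γ : 0# ≤ γ) (0<λ : 0# < λ') where

    mutual
      hangingZ-pos : ∀ p ds → 0# < hangingZ p (node ds)
      hangingZ-pos true ds = subst (0# <_) (sym (hangingZ-true ds))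
        (0≤+0< (0≤* 0≤γ (inj₁ (*-pos 0<λ (forestZ-pos true ds)))) (forestZ-pos false ds))
      hangingZ-pos false ds = subst (0# <_) (sym (hangingZ-false ds))
        (0<+0≤ (*-pos 0<λ (forestZ-pos true ds)) (0≤* 0≤β (inj₁ (forestZ-pos false ds))))

      forestZ-pos : ∀ p ts → 0# < forestZ p ts
      forestZ-pos p []             = subst (0# <_) (sym (forestZ-[] p)) 0<1
      forestZ-pos p (node ds ∷ ts) = subst (0# <_) (sym (forestZ-∷ p (node ds) ts))
        (*-pos (hangingZ-pos p ds) (forestZ-pos p ts))

    forestZ-≢0 : ∀ p ts → forestZ p ts ≢ 0#
    forestZ-≢0 p ts = 0<⇒≢0 (forestZ-pos p ts)

    forestField-pos : ∀ ts → 0# < forestField ts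
    forestField-pos ts = *-pos (forestZ-pos true ts) (0<⁻¹ (forestZ-pos false ts))

    Z-node-≢0 : ∀ ds → Z β γ λ' (node ds) ≢ 0#
    Z-node-≢0 ds = 0<⇒≢0 (subst (0# <_) (sym (trans (Z-node ds) (cong (_+ forestZ false ds) (rootZ-true ds))))
                                 (0<+ (*-pos 0<λ (forestZ-pos true ds)) (forestZ-pos false ds)))

    effField-node : ∀ ds → effField β γ λ' (node ds) ≡ forestField ds
    effField-node ds = begin
      λ' ⁻¹ * (Prob-root β γ λ' (node ds) true / Prob-root β γ λ' (node ds) false)
        ≡⟨ cong (λ' ⁻¹ *_) (cong₂ _/_ (Prob-root-node ds true) (Prob-root-node ds false)) ⟩
      λ' ⁻¹ * ((rootZ true ds / Zₜ) / (forestZ false ds / Zₜ))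
        ≡⟨ cong (λ' ⁻¹ *_) (/-cancelʳ (rootZ true ds) (forestZ-≢0 false ds) (⁻¹-≢0 (Z-node-≢0 ds))) ⟩
      λ' ⁻¹ * (rootZ true ds / forestZ false ds)
        ≡⟨ cong (λ z → λ' ⁻¹ * (z / forestZ false ds)) (rootZ-true ds) ⟩
      λ' ⁻¹ * (λ' * forestZ true ds / forestZ false ds)
        ≡⟨ solve 4 (λ l' l a b' → l' :* (l :* a :* b') := l :* l' :* (a :* b'))
                 refl (λ' ⁻¹) λ' (forestZ true ds) (forestZ false ds ⁻¹) ⟩
      λ' / λ' * forestField ds
        ≡⟨ cong (_* forestField ds) (/-cancel (0<⇒≢0 0<λ)) ⟩
      1# * forestField ds
        ≡⟨ *-identityˡ _ ⟩
      forestField ds ∎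
      where
        open ≡-Reasoning
        Zₜ : Carrier
        Zₜ = Z β γ λ' (node ds)

    CondExpSize-node : ∀ ds s → CondExpSize β γ λ' (node ds) s ≡ rootSizeSum s ds / rootZ s ds
    CondExpSize-node ds s = trans (cong₂ _/_ (conditionalSizeSum-node ds s) (Prob-root-node ds s))
                                  (/-cancelʳ (rootSizeSum s ds) (rootZ-≢0 s) (⁻¹-≢0 (Z-node-≢0 ds)))
      where
        rootZ-≢0 : ∀ s → rootZ s ds ≢ 0#
        rootZ-≢0 true  = subst (_≢ 0#) (sym (rootZ-true ds)) (*-≢0 (0<⇒≢0 0<λ) (forestZ-≢0 true ds))
        rootZ-≢0 false = forestZ-≢0 false ds

    magGap-node : ∀ ds → magGap β γ λ' (node ds) ≡ 1# + forestGap ds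
    magGap-node ds = begin
      CondExpSize β γ λ' (node ds) true - CondExpSize β γ λ' (node ds) false
        ≡⟨ cong₂ _-_ (CondExpSize-node ds true) (CondExpSize-node ds false) ⟩
      rootSizeSum true ds / rootZ true ds - forestSizeSum false ds / forestZ false ds
        ≡⟨ cong₂ (λ v z → v / z - meanSize false ds) (rootSizeSum-true ds) (rootZ-true ds) ⟩
      λ' * (z₁ + v₁) / (λ' * z₁) - meanSize false ds
        ≡⟨ cong (_- meanSize false ds) (trans (cong₂ _/_ (*-comm λ' _) (*-comm λ' _))
                                              (/-cancelʳ (z₁ + v₁) (forestZ-≢0 true ds) (0<⇒≢0 0<λ))) ⟩
      (z₁ + v₁) / z₁ - meanSize false ds
        ≡⟨ solve 4 (λ z v z' m → (z :+ v) :* z' :- m := z :* z' :+ (v :* z' :- m)) refl z₁ v₁ (z₁ ⁻¹) (meanSize false ds) ⟩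
      z₁ / z₁ + forestGap ds
        ≡⟨ cong (_+ forestGap ds) (/-cancel (forestZ-≢0 true ds)) ⟩
      1# + forestGap ds ∎
      where
        open ≡-Reasoning
        z₁ v₁ : Carrier
        z₁ = forestZ true ds
        v₁ = forestSizeSum true ds

    forestField-++ : ∀ ts us → forestField (ts ++ us) ≡ forestField ts * forestField us
    forestField-++ ts us = begin
      forestZ true (ts ++ us) / forestZ false (ts ++ us)
        ≡⟨ cong₂ _/_ (forestZ-++ true ts us) (forestZ-++ false ts us) ⟩
      forestZ true ts * forestZ true us * (forestZ false ts * forestZ false us) ⁻¹
        ≡⟨ cong (forestZ true ts * forestZ true us *_) (⁻¹-* (forestZ-≢0 false ts) (forestZ-≢0 false us)) ⟩
      forestZ true ts * forestZ true us * (forestZ false ts ⁻¹ * forestZ false us ⁻¹)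
        ≡⟨ solve 4 (λ a b c d → a :* b :* (c :* d) := a :* c :* (b :* d)) refl _ _ _ _ ⟩
      forestField ts * forestField us ∎
      where open ≡-Reasoning

    meanSize-++ : ∀ p ts us → meanSize p (ts ++ us) ≡ meanSize p ts + meanSize p us
    meanSize-++ p ts us = begin
      forestSizeSum p (ts ++ us) / forestZ p (ts ++ us)
        ≡⟨ cong₂ _/_ (forestSizeSum-++ p ts us) (forestZ-++ p ts us) ⟩
      (v₁ * z₂ + z₁ * v₂) * (z₁ * z₂) ⁻¹
        ≡⟨ cong ((v₁ * z₂ + z₁ * v₂) *_) (⁻¹-* (forestZ-≢0 p ts) (forestZ-≢0 p us)) ⟩
      (v₁ * z₂ + z₁ * v₂) * (z₁ ⁻¹ * z₂ ⁻¹)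
        ≡⟨ solve 6 (λ v₁ v₂ z₁ z₂ z₁' z₂' → (v₁ :* z₂ :+ z₁ :* v₂) :* (z₁' :* z₂')
                                         := v₁ :* z₁' :* (z₂ :* z₂') :+ v₂ :* z₂' :* (z₁ :* z₁')) refl
             v₁ v₂ z₁ z₂ (z₁ ⁻¹) (z₂ ⁻¹) ⟩
      v₁ / z₁ * (z₂ / z₂) + v₂ / z₂ * (z₁ / z₁)
        ≡⟨ cong₂ (λ x y → v₁ / z₁ * x + v₂ / z₂ * y) (/-cancel (forestZ-≢0 p us)) (/-cancel (forestZ-≢0 p ts)) ⟩
      v₁ / z₁ * 1# + v₂ / z₂ * 1#
        ≡⟨ cong₂ _+_ (*-identityʳ _) (*-identityʳ _) ⟩
      meanSize p ts + meanSize p us ∎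
      where
        open ≡-Reasoning
        z₁ z₂ v₁ v₂ : Carrier
        z₁ = forestZ p ts
        z₂ = forestZ p us
        v₁ = forestSizeSum p ts
        v₂ = forestSizeSum p us

    forestGap-++ : ∀ ts us → forestGap (ts ++ us) ≡ forestGap ts + forestGap us
    forestGap-++ ts us = trans (cong₂ _-_ (meanSize-++ true ts us) (meanSize-++ false ts us))
      (solve 4 (λ a b c d → a :+ b :- (c :+ d) := a :- c :+ (b :- d)) refl _ _ _ _)

    Π-effField : ∀ Ts → Π[ map (effField β γ λ') Ts ] ≡ forestField (concatMap children Ts)
    Π-effField []             = sym (trans (cong₂ _/_ (forestZ-[] true) (forestZ-[] false))
                                           (trans (cong (1# *_) 1⁻¹) (*-identityˡ 1#)))
    Π-effField (node ds ∷ Ts) = trans (cong₂ _*_ (effField-node ds) (Π-effField Ts))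
                                      (sym (forestField-++ ds (concatMap children Ts)))

    Σ-magGap : ∀ Ts → Σ[ map (λ T → magGap β γ λ' T - 1#) Ts ] ≡ forestGap (concatMap children Ts)
    Σ-magGap []             = sym (begin
      forestSizeSum true [] / forestZ true [] - forestSizeSum false [] / forestZ false []
        ≡⟨ cong₂ (λ x y → x / forestZ true [] - y / forestZ false []) (forestSizeSum-[] true) (forestSizeSum-[] false) ⟩
      0# / forestZ true [] - 0# / forestZ false []
        ≡⟨ solve 2 (λ a b → :0 :* a :- :0 :* b := :0) refl _ _ ⟩
      0# ∎)
      where open ≡-Reasoning
    Σ-magGap (node ds ∷ Ts) =
      trans (cong₂ _+_ (trans (cong (_- 1#) (magGap-node ds)) (1+x-1≡x (forestGap ds))) (Σ-magGap Ts))
                                    (sym (forestGap-++ ds (concatMap children Ts)))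
      where
        1+x-1≡x : ∀ x → 1# + x - 1# ≡ x
        1+x-1≡x = solve 1 (λ x → :1 :+ x :- :1 := x) refl

    module Singleton (ds : List Tree) where
      private
        a b v₁ v₀ m₁ m₀ P : Carrier
        a = forestZ true ds
        b = forestZ false ds
        v₁ = forestSizeSum true ds
        v₀ = forestSizeSum false ds
        m₁ = meanSize true ds
        m₀ = meanSize false ds
        P = λ' * forestField ds
        b≢0 : b ≢ 0#
        b≢0 = forestZ-≢0 false ds

        0<P : 0# < P
        0<P = *-pos 0<λ (forestField-pos ds)

        a≡rb : a ≡ forestField ds * b
        a≡rb = sym (/-*-cancel a b≢0)

        v₁≡m₁a : v₁ ≡ m₁ * a
        v₁≡m₁a = sym (/-*-cancel v₁ (forestZ-≢0 true ds))

        v₀≡m₀b : v₀ ≡ m₀ * b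
        v₀≡m₀b = sym (/-*-cancel v₀ b≢0)

        partitions : ∀ c₁ c₀ → c₁ * (λ' * a) + c₀ * b ≡ (c₀ + c₁ * P) * b
        partitions c₁ c₀ = trans (cong (λ a → c₁ * (λ' * a) + c₀ * b) a≡rb)
          (solve 5 (λ c₁ c₀ l r b → c₁ :* (l :* (r :* b)) :+ c₀ :* b := (c₀ :+ c₁ :* (l :* r)) :* b) refl
             c₁ c₀ λ' (forestField ds) b)

        sizeSums : ∀ c₁ c₀ → c₁ * (λ' * (a + v₁)) + c₀ * v₀ ≡ (c₀ * m₀ + c₁ * P * (1# + m₁)) * b
        sizeSums c₁ c₀ = begin
          c₁ * (λ' * (a + v₁)) + c₀ * v₀
            ≡⟨ cong₂ (λ v w → c₁ * (λ' * (a + v)) + c₀ * w) v₁≡m₁a v₀≡m₀b ⟩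
          c₁ * (λ' * (a + m₁ * a)) + c₀ * (m₀ * b)
            ≡⟨ cong (λ a → c₁ * (λ' * (a + m₁ * a)) + c₀ * (m₀ * b)) a≡rb ⟩
          c₁ * (λ' * (forestField ds * b + m₁ * (forestField ds * b))) + c₀ * (m₀ * b)
            ≡⟨ solve 7 (λ c₁ c₀ l r b m₁ m₀ → c₁ :* (l :* (r :* b :+ m₁ :* (r :* b))) :+ c₀ :* (m₀ :* b)
                                            := (c₀ :* m₀ :+ c₁ :* (l :* r) :* (:1 :+ m₁)) :* b) refl
                 c₁ c₀ λ' (forestField ds) b m₁ m₀ ⟩
          (c₀ * m₀ + c₁ * P * (1# + m₁)) * b ∎
          where open ≡-Reasoning

      forestField-[node] : forestField (node ds ∷ []) ≡ fieldStep P
      forestField-[node] = begin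
        forestZ true (node ds ∷ []) / forestZ false (node ds ∷ [])
          ≡⟨ cong₂ _/_ (trans forestZ-[ node ds ] (hangingZ-true ds))
                       (trans forestZ-[ node ds ] (hangingZ-false ds)) ⟩
        (γ * (λ' * a) + b) / (λ' * a + β * b)
          ≡⟨ cong₂ _/_ (trans (cong (γ * (λ' * a) +_) (sym (*-identityˡ b))) (partitions γ 1#))
                       (trans (cong (_+ β * b) (sym (*-identityˡ (λ' * a)))) (partitions 1# β)) ⟩
        (1# + γ * P) * b / ((β + 1# * P) * b)
          ≡⟨ cong (λ x → (1# + γ * P) * b / ((β + x) * b)) (*-identityˡ P) ⟩
        (1# + γ * P) * b / ((β + P) * b)
          ≡⟨ /-cancelʳ (1# + γ * P) (0<⇒≢0 (0<β+P 0≤β 0≤γ 0<P)) b≢0 ⟩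
        fieldStep P ∎
        where open ≡-Reasoning

      private
        [1+m₁]-m₀ : 1# + m₁ - m₀ ≡ 1# + forestGap ds
        [1+m₁]-m₀ = solve 2 (λ x y → :1 :+ x :- y := :1 :+ (x :- y)) refl m₁ m₀

        meanSize-true : meanSize true (node ds ∷ []) ≡ m₀ + π₁ P * (1# + forestGap ds)
        meanSize-true = begin
          forestSizeSum true (node ds ∷ []) / forestZ true (node ds ∷ [])
            ≡⟨ cong₂ _/_ (trans forestSizeSum-[ node ds ] (hangingSizeSum-true ds))
                         (trans forestZ-[ node ds ] (hangingZ-true ds)) ⟩
          (γ * (λ' * (a + v₁)) + v₀) / (γ * (λ' * a) + b)
            ≡⟨ cong₂ _/_ (trans (cong (γ * (λ' * (a + v₁)) +_) (sym (*-identityˡ v₀))) (sizeSums γ 1#))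
                         (trans (cong (γ * (λ' * a) +_) (sym (*-identityˡ b))) (partitions γ 1#)) ⟩
          (1# * m₀ + γ * P * (1# + m₁)) * b / ((1# + γ * P) * b)
            ≡⟨ /-cancelʳ _ (0<⇒≢0 (0<1+γP 0≤β 0≤γ 0<P)) b≢0 ⟩
          (1# * m₀ + γ * P * (1# + m₁)) / (1# + γ * P)
            ≡⟨ weighted-mean (γ * P) 1# m₀ (1# + m₁) (0<⇒≢0 (0<1+γP 0≤β 0≤γ 0<P)) ⟩
          m₀ + π₁ P * (1# + m₁ - m₀)
            ≡⟨ cong (λ t → m₀ + π₁ P * t) [1+m₁]-m₀ ⟩
          m₀ + π₁ P * (1# + forestGap ds) ∎
          where open ≡-Reasoning

        meanSize-false : meanSize false (node ds ∷ []) ≡ m₀ + π₀ P * (1# + forestGap ds)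
        meanSize-false = begin
          forestSizeSum false (node ds ∷ []) / forestZ false (node ds ∷ [])
            ≡⟨ cong₂ _/_ (trans forestSizeSum-[ node ds ] (hangingSizeSum-false ds))
                         (trans forestZ-[ node ds ] (hangingZ-false ds)) ⟩
          (λ' * (a + v₁) + β * v₀) / (λ' * a + β * b)
            ≡⟨ cong₂ _/_ (trans (cong (_+ β * v₀) (sym (*-identityˡ _))) (sizeSums 1# β))
                         (trans (cong (_+ β * b) (sym (*-identityˡ _))) (partitions 1# β)) ⟩
          (β * m₀ + 1# * P * (1# + m₁)) * b / ((β + 1# * P) * b)
            ≡⟨ cong (λ x → (β * m₀ + x * (1# + m₁)) * b / ((β + x) * b)) (*-identityˡ P) ⟩
          (β * m₀ + P * (1# + m₁)) * b / ((β + P) * b)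
            ≡⟨ /-cancelʳ _ (0<⇒≢0 (0<β+P 0≤β 0≤γ 0<P)) b≢0 ⟩
          (β * m₀ + P * (1# + m₁)) / (β + P)
            ≡⟨ weighted-mean P β m₀ (1# + m₁) (0<⇒≢0 (0<β+P 0≤β 0≤γ 0<P)) ⟩
          m₀ + π₀ P * (1# + m₁ - m₀)
            ≡⟨ cong (λ t → m₀ + π₀ P * t) [1+m₁]-m₀ ⟩
          m₀ + π₀ P * (1# + forestGap ds) ∎
          where open ≡-Reasoning

      forestGap-[node] : forestGap (node ds ∷ []) ≡ (π₁ P - π₀ P) * (1# + forestGap ds)
      forestGap-[node] = trans (cong₂ _-_ meanSize-true meanSize-false)
        (solve 4 (λ m x y t → m :+ x :* t :- (m :+ y :* t) := (x :- y) :* t) refl m₀ (π₁ P) (π₀ P) (1# + forestGap ds))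

    effField-glue : ∀ Ts → effField β γ λ' (glue Ts) ≡ fieldStep (λ' * forestField (concatMap children Ts))
    effField-glue Ts = trans (effField-node (node cs ∷ [])) (Singleton.forestField-[node] cs)
      where
        cs : List Tree
        cs = concatMap children Ts

    magGap-glue : ∀ Ts → let P = λ' * forestField (concatMap children Ts) in
      magGap β γ λ' (glue Ts) ≡ 1# + (π₁ P - π₀ P) * (1# + forestGap (concatMap children Ts))
    magGap-glue Ts = trans (magGap-node (node cs ∷ [])) (cong (1# +_) (Singleton.forestGap-[node] cs))
      where
        cs : List Tree
        cs = concatMap children Ts

lemma3p1 : (F : OrderedField) → let open OrderedField F in let open Gibbs F in
    (β γ λ' : Carrier) → antiferromagnetic β γ → 0# < λ' →
    (Ts : List Tree) →
    let R  = effField β γ λ' (glue Ts)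
        M  = magGap β γ λ' (glue Ts)
        ΠR = Π[ map (effField β γ λ') Ts ]
    in (R ≡ (1# + γ * λ' * ΠR) * ((β + λ' * ΠR) ⁻¹))
       × (M ≡ 1# - ω β γ R * (1# + Σ[ map (λ T → magGap β γ λ' T - 1#) Ts ]))
       × (γ < R) × ((β ≡ 0#) ⊎ (R < β ⁻¹))
       × (0# < ω β γ R) × (ω β γ R < 1#)
lemma3p1 F β γ λ' (0≤β , 0≤γ , _ , βγ<1 , ¬β≡0≡γ) 0<λ Ts =
    R≡ , M≡
  , subst (γ <_) (sym R≡fieldStep) (γ<fieldStep 0≤β 0≤γ 0<P βγ<1)
  , ⊎.map₂ (subst (_< β ⁻¹) (sym R≡fieldStep)) (fieldStep<β⁻¹ 0≤β 0≤γ 0<P βγ<1)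
  , subst (λ R → 0# < ω β γ R) (sym R≡fieldStep) (0<ω 0≤β 0≤γ 0<P βγ<1)
  , subst (λ R → ω β γ R < 1#) (sym R≡fieldStep) (ω<1 0≤β 0≤γ 0<P βγ<1 ¬β≡0≡γ)
  where
    open OrderedField F
    open Gibbs F
    open OrderedFieldProperties F
    open TreeRecursion F β γ
    open PartitionFunctions F β γ λ'
    open Positive 0≤β 0≤γ 0<λ
    open ≡ using (refl; sym; cong; cong₂; subst; module ≡-Reasoning)
    open ≡-Reasoning

    R M ΠR ΣM P : Carrier
    R  = effField β γ λ' (glue Ts)
    M  = magGap β γ λ' (glue Ts)
    ΠR = Π[ map (effField β γ λ') Ts ]
    ΣM = Σ[ map (λ T → magGap β γ λ' T - 1#) Ts ]
    P  = λ' * forestField (concatMap children Ts)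

    0<P : 0# < P
    0<P = *-pos 0<λ (forestField-pos (concatMap children Ts))

    R≡fieldStep : R ≡ fieldStep P
    R≡fieldStep = effField-glue Ts

    R≡ : R ≡ (1# + γ * λ' * ΠR) / (β + λ' * ΠR)
    R≡ = begin
      R                                       ≡⟨ R≡fieldStep ⟩
      fieldStep P                             ≡⟨ cong (λ r → fieldStep (λ' * r)) (Π-effField Ts) ⟨
      fieldStep (λ' * ΠR)                     ≡⟨ cong (λ x → (1# + x) / (β + λ' * ΠR)) (*-assoc γ λ' ΠR) ⟨
      (1# + γ * λ' * ΠR) / (β + λ' * ΠR)      ∎

    M≡ : M ≡ 1# - ω β γ R * (1# + ΣM)
    M≡ = begin
      M
        ≡⟨ magGap-glue Ts ⟩
      1# + (π₁ P - π₀ P) * (1# + forestGap (concatMap children Ts))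
        ≡⟨ solve 3 (λ x y t → :1 :+ (x :- y) :* t := :1 :- (y :- x) :* t) refl (π₁ P) (π₀ P) _ ⟩
      1# - (π₀ P - π₁ P) * (1# + forestGap (concatMap children Ts))
        ≡⟨ cong₂ (λ w g → 1# - w * (1# + g)) (ω-fieldStep 0≤β 0≤γ 0<P βγ<1) (Σ-magGap Ts) ⟨
      1# - ω β γ (fieldStep P) * (1# + ΣM)
        ≡⟨ cong (λ r → 1# - ω β γ r * (1# + ΣM)) R≡fieldStep ⟨
      1# - ω β γ R * (1# + ΣM) ∎
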